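{- For every $B\subseteq C_0$ presented at time $0$ to the network $\mathcal L$ and every $c\in supp_{r_2}(B)$, at least $m(1-\epsilon)$ of the neurons in $reps(c)$ fire at time $level(c)$.
   Context: Concept hierarchies: fix positive integers $\ell_{max},n,k$. A universal set $D$ of concepts is partitioned into disjoint sets $D_0,\dots,D_{\ell_{max}}$ with $|D_0|=n$; for $c\in D_\ell$ write $level(c)=\ell$. A concept hierarchy $\mathcal C$ consists of $C\subseteq D$, with $C_\ell=C\cap D_\ell$, and for each $c\in C_\ell$, $1\le\ell\le\ell_{max}$, a set $children(c)\subseteq C_{\ell-1}$, such that $|C_{\ell_{max}}|=k$, $|children(c)|=k$ for all $c\in C_\ell$ with $\ell\ge1$, and $children(c)\cap children(c')=\emptyset$ for distinct $c,c'\in C_\ell$, $\ell\ge1$. Support: for $B\subseteq D_0$ and $r\in[0,1]$, let $B(0)=B\cap C_0$ and for $1\le\ell\le\ell_{max}$, $B(\ell)=\{c\in C_\ell: |children(c)\cap B(\ell-1)|\ge rk\}$; $supp_r(B)=\bigcup_{0\le\ell\le\ell_{max}}B(\ell)$. The network $\mathcal L$: reals $r_1,r_2,\epsilon\in[0,1]$, a real connectivity coefficient $a$, with $r_1\le a r_2(1-\epsilon)$, and a positive integer $m$. Neurons are partitioned into layers $N_0,\dots,N_{\ell_{max}}$. Each $c\in C$ has a set $reps(c)\subseteq N_{level(c)}$ of exactly $m$ neurons, these sets pairwise disjoint. There is a set $E$ of pairs $(u,v)$ with $v\in reps(c)$ and $u\in reps(c')$ for some $c\in C$, $c'\in children(c)$;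 for $u\in N_{\ell-1}$, $v\in N_\ell$, $w(u,v)=1$ iff $(u,v)\in E$, else $0$. Threshold $\tau=ar_2km(1-\epsilon)$. A fixed set $F$ of failed neurons (which never fire) satisfies $|reps(c)\setminus F|\ge m(1-\epsilon)$ for every $c\in C$, and for every $c\in C$ with $level(c)\ge1$, every $v\in reps(c)$ and every $c'\in children(c)$, there are at least $am(1-\epsilon)$ neurons $u\in reps(c')\setminus F$ with $(u,v)\in E$. Time is discrete. $B\subseteq C_0$ is presented at time $0$: the layer-$0$ neurons firing at time $0$ are exactly $\bigcup_{b\in B}reps(b)\setminus F$, and no layer-$0$ neuron fires at any other time. Non-input neurons do not fire at time $0$; a non-failed $v\in N_\ell$, $\ell\ge1$, fires at time $t\ge1$ iff $\sum_{u\in N_{\ell-1}}w(u,v)x_u(t-1)\ge\tau$, where $x_u(t-1)\in\{0,1\}$ indicates whether $u$ fires at time $t-1$. -}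

module Defs where

import Level
open import Level using (Level; _⊔_) renaming (suc to lsuc)
open import Data.Nat as ℕ using (ℕ; zero; suc)
open import Data.Bool using (Bool; true; false; _∧_; not)
open import Data.Fin using (Fin)
open import Data.Fin.Subset using (Subset; _∈_; _∉_; _⊆_; _∩_; ∁; ∣_∣)
open import Data.Vec using (tabulate)
open import Data.Product using (Σ; _×_; ∃)
open import Relation.Nullary using (¬_)
open import Relation.Binary.PropositionalEquality using (_≡_; _≢_)
open import Relation.Binary.Structures using (IsTotalOrder)
open import Algebra.Bundles using (CommutativeRing)

-- Ordered fields (the real numbers ℝ are one; agda-stdlib has no ℝ,
-- so the theorem is stated for an arbitrary ordered field).

record OrderedField c ℓ₁ ℓ₂ : Set (lsuc (c ⊔ ℓ₁ ⊔ ℓ₂)) where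
  field
    commutativeRing : CommutativeRing c ℓ₁
  open CommutativeRing commutativeRing public
  field
    _≤_           : Carrier → Carrier → Set ℓ₂
    isTotalOrder  : IsTotalOrder _≈_ _≤_
    +-mono-≤      : ∀ {x y} z → x ≤ y → (x + z) ≤ (y + z)
    *-nonneg      : ∀ {x y} → 0# ≤ x → 0# ≤ y → 0# ≤ (x * y)
    0≉1           : ¬ (0# ≈ 1#)
    inverse       : ∀ x → ¬ (x ≈ 0#) → Σ Carrier (λ y → (x * y) ≈ 1#)

  fromℕ : ℕ → Carrier
  fromℕ zero    = 0#
  fromℕ (suc n) = 1# + fromℕ n

  InUnit : Carrier → Set ℓ₂
  InUnit x = (0# ≤ x) × (x ≤ 1#)

-- Concept hierarchies.  The universal set D is the finite set Fin nD;
-- level d ∈ {0,…,ℓmax} says which block D_ℓ of the partition d lies in.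

levelSet : ∀ {nD} → (Fin nD → ℕ) → ℕ → Subset nD
levelSet level ℓ = tabulate (λ d → level d ℕ.≡ᵇ ℓ)

record ConceptHierarchy (ℓmax n k : ℕ) : Set where
  field
    nD         : ℕ
    level      : Fin nD → ℕ
    level≤     : ∀ d → level d ℕ.≤ ℓmax
    D₀-size    : ∣ levelSet level 0 ∣ ≡ n
    C          : Subset nD
    children   : Fin nD → Subset nD
    top-size   : ∣ C ∩ levelSet level ℓmax ∣ ≡ k
    children-⊆ : ∀ c → c ∈ C → 1 ℕ.≤ level c →
                 ∀ c' → c' ∈ children c → (c' ∈ C) × (suc (level c') ≡ level c)
    children-size : ∀ c → c ∈ C → 1 ℕ.≤ level c → ∣ children c ∣ ≡ k
    children-disj : ∀ c c' → c ∈ C → c' ∈ C → 1 ℕ.≤ level c → level c ≡ level c' →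
                    c ≢ c' → ∀ d → d ∈ children c → d ∉ children c'

module Support {ℓmax n k : ℕ} (H : ConceptHierarchy ℓmax n k)
               {c ℓ₁ ℓ₂} (R : OrderedField c ℓ₁ ℓ₂) where
  open ConceptHierarchy H
  open OrderedField R

  -- c ∈ B(ℓ)   ("|children(c) ∩ B(ℓ-1)| ≥ rk" is expressed as: there is a
  --             set S ⊆ children(c) ∩ B(ℓ-1) with r·k ≤ |S|)
  InB : Subset nD → Carrier → ℕ → Fin nD → Set (c ⊔ ℓ₂)
  InB B r zero    d = Level.Lift (c ⊔ ℓ₂) ((d ∈ B) × (d ∈ C) × (level d ≡ 0))
  InB B r (suc ℓ) d = Level.Lift (c ⊔ ℓ₂) ((d ∈ C) × (level d ≡ suc ℓ)) ×
    Σ (Subset nD) (λ S → (∀ e → e ∈ S → Level.Lift (c ⊔ ℓ₂) (e ∈ children d) × InB B r ℓ e)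
                         × ((r * fromℕ k) ≤ fromℕ ∣ S ∣))

  InSupp : Subset nD → Carrier → Fin nD → Set (c ⊔ ℓ₂)
  InSupp B r d = Σ ℕ (λ ℓ → Level.Lift (c ⊔ ℓ₂) (ℓ ℕ.≤ ℓmax) × InB B r ℓ d)

-- The network 𝓛 (neurons are Fin nN, layer u = ℓ means u ∈ N_ℓ).

record Network {ℓmax n k : ℕ} (H : ConceptHierarchy ℓmax n k)
               {c ℓ₁ ℓ₂} (R : OrderedField c ℓ₁ ℓ₂)
               (r₁ r₂ ε a : OrderedField.Carrier R) (m : ℕ) : Set (c ⊔ ℓ₂) where
  open ConceptHierarchy H
  open OrderedField R
  field
    r₁∈[0,1] : InUnit r₁
    r₂∈[0,1] : InUnit r₂
    ε∈[0,1]  : InUnit ε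
    r₁≤      : r₁ ≤ (a * (r₂ * (1# - ε)))
    nN     : ℕ
    layer  : Fin nN → ℕ
    layer≤ : ∀ u → layer u ℕ.≤ ℓmax
    reps   : Fin nD → Subset nN
    reps-size  : ∀ d → d ∈ C → ∣ reps d ∣ ≡ m
    reps-layer : ∀ d → d ∈ C → ∀ u → u ∈ reps d → layer u ≡ level d
    reps-disj  : ∀ d d' → d ∈ C → d' ∈ C → d ≢ d' → ∀ u → u ∈ reps d → u ∉ reps d'
    E    : Fin nN → Fin nN → Bool
    E-ok : ∀ u v → E u v ≡ true →
           Σ (Fin nD) (λ d → Σ (Fin nD) (λ d' →
             (d ∈ C) × (1 ℕ.≤ level d) × (d' ∈ children d) × (v ∈ reps d) × (u ∈ reps d')))
    F : Subset nN
    F-reps  : ∀ d → d ∈ C → (fromℕ m * (1# - ε)) ≤ fromℕ ∣ reps d ∩ ∁ F ∣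
    F-edges : ∀ d → d ∈ C → 1 ℕ.≤ level d → ∀ v → v ∈ reps d → ∀ d' → d' ∈ children d →
              (a * (fromℕ m * (1# - ε))) ≤ fromℕ ∣ reps d' ∩ (∁ F ∩ tabulate (λ u → E u v)) ∣

  τ : Carrier
  τ = a * (r₂ * (fromℕ k * (fromℕ m * (1# - ε))))

  w : Fin nN → Fin nN → Bool
  w u v = (suc (layer u) ℕ.≡ᵇ layer v) ∧ E u v

  input : (ℕ → Fin nN → Bool) → ℕ → Fin nN → ℕ
  input x t v = ∣ tabulate (λ u → w u v ∧ x t u) ∣

  -- x is the firing pattern (x t u ≡ true iff u fires at time t) of the
  -- network when B ⊆ C_0 is presented at time 0.
  record IsExecution (B : Subset nD) (x : ℕ → Fin nN → Bool) : Set (c ⊔ ℓ₂) where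
    field
      failed-silent : ∀ t u → u ∈ F → x t u ≡ false
      input-fires   : ∀ u → layer u ≡ 0 →
                      x 0 u ≡ true → (u ∉ F) × Σ (Fin nD) (λ b → (b ∈ B) × (u ∈ reps b))
      input-fires⁻  : ∀ u → layer u ≡ 0 →
                      (u ∉ F) → ∀ b → b ∈ B → u ∈ reps b → x 0 u ≡ true
      input-later   : ∀ t u → layer u ≡ 0 → x (suc t) u ≡ false
      noninput-0    : ∀ u → 1 ℕ.≤ layer u → x 0 u ≡ false
      rule          : ∀ t v → 1 ℕ.≤ layer v → v ∉ F →
                      x (suc t) v ≡ true → τ ≤ fromℕ (input x t v)
      rule⁻         : ∀ t v → 1 ℕ.≤ layer v → v ∉ F →
                      τ ≤ fromℕ (input x t v) → x (suc t) v ≡ true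

{-# OPTIONS --safe #-}
-- By induction on ℓ, every non-failed representative of a concept in B(ℓ) fires at
-- time ℓ. For ℓ + 1, a representative v of c sees, for each of the at least r₂k children
-- of c in B(ℓ), at least a·m(1 − ε) live in-neighbours; these all fire at time ℓ and
-- lie in pairwise disjoint sets reps(c′), so v's input is at least r₂k · a·m(1 − ε) = τ.
-- If a ≤ 0 then τ ≤ 0 and the threshold is met trivially.
module Submission where

open import Defs
open import Data.Nat using (ℕ; _≤_)
open import Data.Bool using (Bool)
open import Data.Fin using (Fin)
open import Data.Fin.Subset using (Subset; _⊆_; _∩_; ∣_∣)
open import Data.Vec using (tabulate)

open import Level using (lift; lower)
open import Data.Nat as ℕ using (zero; suc; z≤n; s≤s)
import Data.Nat.Properties as ℕₚ
open import Data.Bool using (true; _∧_)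
open import Data.Bool.Properties using (T-≡)
import Data.Fin as Fin
import Data.Fin.Properties as Finₚ
open import Data.Fin.Subset using (_∈_; _∉_; ∁; inside; outside)
open import Data.Fin.Subset.Properties using (p⊆q⇒∣p∣≤∣q∣; x∈p∩q⁺; x∈p∩q⁻; x∈∁p⇒x∉p; x∉p⇒x∈∁p)
open import Data.Vec using (_∷_; []; here; there)
open import Data.Vec.Properties using (lookup∘tabulate; lookup⇒[]=; []=⇒lookup)
open import Data.Product using (_×_; _,_; proj₁; proj₂)
open import Data.Sum using (inj₁; inj₂)
open import Function.Bundles using (Equivalence)
open import Relation.Binary.Bundles using (TotalOrder)
open import Relation.Binary.PropositionalEquality as ≡ using (_≡_; _≢_; refl)
import Relation.Binary.Reasoning.PartialOrder as PartialOrderReasoning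
import Algebra.Properties.Ring as RingProperties
import Algebra.Properties.CommutativeSemigroup as CommutativeSemigroupProperties

∈-tabulate⁺ : ∀ {n} (f : Fin n → Bool) {i} → f i ≡ true → i ∈ tabulate f
∈-tabulate⁺ f {i} fi≡true = lookup⇒[]= i (tabulate f) (≡.trans (lookup∘tabulate f i) fi≡true)

∈-tabulate⁻ : ∀ {n} (f : Fin n → Bool) {i} → i ∈ tabulate f → f i ≡ true
∈-tabulate⁻ f {i} i∈ = ≡.trans (≡.sym (lookup∘tabulate f i)) ([]=⇒lookup i∈)

∣p∣≡∣p∩q∣+∣p∩∁q∣ : ∀ {n} (p q : Subset n) → ∣ p ∣ ≡ ∣ p ∩ q ∣ ℕ.+ ∣ p ∩ ∁ q ∣
∣p∣≡∣p∩q∣+∣p∩∁q∣ []            []            = refl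
∣p∣≡∣p∩q∣+∣p∩∁q∣ (outside ∷ p) (_ ∷ q)       = ∣p∣≡∣p∩q∣+∣p∩∁q∣ p q
∣p∣≡∣p∩q∣+∣p∩∁q∣ (inside ∷ p)  (inside ∷ q)  = ≡.cong suc (∣p∣≡∣p∩q∣+∣p∩∁q∣ p q)
∣p∣≡∣p∩q∣+∣p∩∁q∣ (inside ∷ p)  (outside ∷ q) =
  ≡.trans (≡.cong suc (∣p∣≡∣p∩q∣+∣p∩∁q∣ p q)) (≡.sym (ℕₚ.+-suc _ _))

module OrderedFieldProperties {c ℓ₁ ℓ₂} (R : OrderedField c ℓ₁ ℓ₂) where
  open OrderedField R
    renaming (_≤_ to infix 4 _⊑_; refl to ≈-refl; sym to ≈-sym; trans to ≈-trans)

  totalOrder : TotalOrder c ℓ₁ ℓ₂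
  totalOrder = record { Carrier = Carrier ; _≈_ = _≈_ ; _≤_ = _⊑_ ; isTotalOrder = isTotalOrder }

  open TotalOrder totalOrder public
    using (total; poset) renaming (refl to ⊑-refl; reflexive to ⊑-reflexive; trans to ⊑-trans)
  open PartialOrderReasoning poset

  x⊑y⇒0⊑y-x : ∀ {x y} → x ⊑ y → 0# ⊑ y - x
  x⊑y⇒0⊑y-x {x} {y} x⊑y = begin
    0#     ≈⟨ -‿inverseʳ x ⟨
    x - x  ≤⟨ +-mono-≤ (- x) x⊑y ⟩
    y - x  ∎

  +-mono-⊑ : ∀ {x y u v} → x ⊑ y → u ⊑ v → x + u ⊑ y + v
  +-mono-⊑ {x} {y} {u} {v} x⊑y u⊑v = begin
    x + u  ≤⟨ +-mono-≤ u x⊑y ⟩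
    y + u  ≈⟨ +-comm y u ⟩
    u + y  ≤⟨ +-mono-≤ y u⊑v ⟩
    v + y  ≈⟨ +-comm v y ⟩
    y + v  ∎

  *-monoʳ-⊑ : ∀ {x y z} → 0# ⊑ z → x ⊑ y → x * z ⊑ y * z
  *-monoʳ-⊑ {x} {y} {z} 0⊑z x⊑y = begin
    x * z                  ≈⟨ +-identityˡ (x * z) ⟨
    0# + x * z             ≤⟨ +-mono-≤ (x * z) (*-nonneg (x⊑y⇒0⊑y-x x⊑y) 0⊑z) ⟩
    (y - x) * z + x * z    ≈⟨ distribʳ z (y - x) x ⟨
    (y - x + x) * z        ≈⟨ *-congʳ (+-assoc y (- x) x) ⟩
    (y + (- x + x)) * z    ≈⟨ *-congʳ (+-congˡ (-‿inverseˡ x)) ⟩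
    (y + 0#) * z           ≈⟨ *-congʳ (+-identityʳ y) ⟩
    y * z                  ∎

  *-monoˡ-⊑ : ∀ {x y z} → 0# ⊑ z → x ⊑ y → z * x ⊑ z * y
  *-monoˡ-⊑ {x} {y} {z} 0⊑z x⊑y = begin
    z * x  ≈⟨ *-comm z x ⟩
    x * z  ≤⟨ *-monoʳ-⊑ 0⊑z x⊑y ⟩
    y * z  ≈⟨ *-comm y z ⟩
    z * y  ∎

  -- In a total order either 0 ⊑ 1 or 0 ⊑ -1, and in the latter case 1 = (-1)(-1) ⊒ 0.
  0⊑1 : 0# ⊑ 1#
  0⊑1 with total 0# 1#
  ... | inj₁ 0⊑1 = 0⊑1
  ... | inj₂ 1⊑0 = begin
    0#               ≤⟨ *-nonneg 0⊑-1 0⊑-1 ⟩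
    - 1# * - 1#      ≈⟨ -‿distribˡ-* 1# (- 1#) ⟨
    - (1# * - 1#)    ≈⟨ -‿cong (*-identityˡ (- 1#)) ⟩
    - - 1#           ≈⟨ -‿involutive 1# ⟩
    1#               ∎
    where
      open RingProperties ring using (-‿distribˡ-*; -‿involutive)
      0⊑-1 : 0# ⊑ - 1#
      0⊑-1 = ⊑-trans (x⊑y⇒0⊑y-x 1⊑0) (⊑-reflexive (+-identityˡ (- 1#)))

  0⊑fromℕ : ∀ n → 0# ⊑ fromℕ n
  0⊑fromℕ zero    = ⊑-refl
  0⊑fromℕ (suc n) = ⊑-trans (⊑-reflexive (≈-sym (+-identityʳ 0#))) (+-mono-⊑ 0⊑1 (0⊑fromℕ n))

  fromℕ-cong : ∀ {i j} → i ≡ j → fromℕ i ≈ fromℕ j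
  fromℕ-cong refl = ≈-refl

  fromℕ-+ : ∀ i j → fromℕ (i ℕ.+ j) ≈ fromℕ i + fromℕ j
  fromℕ-+ zero    j = ≈-sym (+-identityˡ (fromℕ j))
  fromℕ-+ (suc i) j = ≈-trans (+-congˡ (fromℕ-+ i j)) (≈-sym (+-assoc 1# (fromℕ i) (fromℕ j)))

  fromℕ-mono : ∀ {i j} → i ≤ j → fromℕ i ⊑ fromℕ j
  fromℕ-mono {i} {j} i≤j = begin
    fromℕ i                        ≈⟨ +-identityʳ (fromℕ i) ⟨
    fromℕ i + 0#                   ≤⟨ +-mono-⊑ ⊑-refl (0⊑fromℕ (j ℕ.∸ i)) ⟩
    fromℕ i + fromℕ (j ℕ.∸ i)      ≈⟨ fromℕ-+ i (j ℕ.∸ i) ⟨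
    fromℕ (i ℕ.+ (j ℕ.∸ i))          ≈⟨ fromℕ-cong (ℕₚ.m+[n∸m]≡n i≤j) ⟩
    fromℕ j                        ∎

  a*q⊑y⇒a*p⊑y : ∀ {a p q y} → 0# ⊑ p → p ⊑ q → 0# ⊑ y → a * q ⊑ y → a * p ⊑ y
  a*q⊑y⇒a*p⊑y {a} {p} {q} {y} 0⊑p p⊑q 0⊑y aq⊑y with total 0# a
  ... | inj₁ 0⊑a = ⊑-trans (*-monoˡ-⊑ 0⊑a p⊑q) aq⊑y
  ... | inj₂ a⊑0 = begin
    a * p   ≤⟨ *-monoʳ-⊑ 0⊑p a⊑0 ⟩
    0# * p  ≈⟨ zeroˡ p ⟩
    0#      ≤⟨ 0⊑y ⟩
    y       ∎

  ∣S∣*α⊑∣U∣ : ∀ {p q} (α : Carrier) (S : Subset p) (T : Fin p → Subset q) (U : Subset q) →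
              (∀ {e} → e ∈ S → T e ⊆ U) →
              (∀ {e e′} → e ∈ S → e′ ∈ S → e ≢ e′ → ∀ {u} → u ∈ T e → u ∉ T e′) →
              (∀ {e} → e ∈ S → α ⊑ fromℕ ∣ T e ∣) →
              fromℕ ∣ S ∣ * α ⊑ fromℕ ∣ U ∣
  ∣S∣*α⊑∣U∣ α [] T U _ _ _ = ⊑-trans (⊑-reflexive (zeroˡ α)) (0⊑fromℕ ∣ U ∣)
  ∣S∣*α⊑∣U∣ α (outside ∷ S) T U T⊆U disjoint large =
    ∣S∣*α⊑∣U∣ α S (λ e → T (Fin.suc e)) U (λ e∈ → T⊆U (there e∈))
      (λ e∈ e′∈ e≢e′ → disjoint (there e∈) (there e′∈) (λ eq → e≢e′ (Finₚ.suc-injective eq)))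
      (λ e∈ → large (there e∈))
  ∣S∣*α⊑∣U∣ α (inside ∷ S) T U T⊆U disjoint large = begin
    fromℕ (suc ∣ S ∣) * α              ≈⟨ distribʳ α 1# (fromℕ ∣ S ∣) ⟩
    1# * α + fromℕ ∣ S ∣ * α           ≈⟨ +-congʳ (*-identityˡ α) ⟩
    α + fromℕ ∣ S ∣ * α                ≤⟨ +-mono-⊑ head-bound tail-bound ⟩
    fromℕ ∣ U ∩ T₀ ∣ + fromℕ ∣ U ∩ ∁ T₀ ∣  ≈⟨ fromℕ-+ ∣ U ∩ T₀ ∣ ∣ U ∩ ∁ T₀ ∣ ⟨
    fromℕ (∣ U ∩ T₀ ∣ ℕ.+ ∣ U ∩ ∁ T₀ ∣)    ≈⟨ fromℕ-cong (∣p∣≡∣p∩q∣+∣p∩∁q∣ U T₀) ⟨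
    fromℕ ∣ U ∣                        ∎
    where
      T₀ : Subset _
      T₀ = T Fin.zero
      head-bound : α ⊑ fromℕ ∣ U ∩ T₀ ∣
      head-bound = ⊑-trans (large here)
        (fromℕ-mono (p⊆q⇒∣p∣≤∣q∣ (λ u∈T₀ → x∈p∩q⁺ (T⊆U here u∈T₀ , u∈T₀))))
      tail-bound : fromℕ ∣ S ∣ * α ⊑ fromℕ ∣ U ∩ ∁ T₀ ∣
      tail-bound = ∣S∣*α⊑∣U∣ α S (λ e → T (Fin.suc e)) (U ∩ ∁ T₀)
        (λ e∈ u∈ → x∈p∩q⁺ (T⊆U (there e∈) u∈ , x∉p⇒x∈∁p (disjoint (there e∈) here (λ ()) u∈)))
        (λ e∈ e′∈ e≢e′ → disjoint (there e∈) (there e′∈) (λ eq → e≢e′ (Finₚ.suc-injective eq)))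
        (λ e∈ → large (there e∈))

module SupportProperties {ℓmax n k} (H : ConceptHierarchy ℓmax n k)
                         {c ℓ₁ ℓ₂} (R : OrderedField c ℓ₁ ℓ₂) where
  open ConceptHierarchy H
  open Support H R

  InB⇒∈C×level≡ : ∀ {B r} ℓ {d} → InB B r ℓ d → d ∈ C × level d ≡ ℓ
  InB⇒∈C×level≡ zero    (lift (_ , d∈C , level≡)) = d∈C , level≡
  InB⇒∈C×level≡ (suc ℓ) (lift (d∈C , level≡) , _) = d∈C , level≡

module Execution {ℓmax n k} {H : ConceptHierarchy ℓmax n k}
                 {c ℓ₁ ℓ₂} {R : OrderedField c ℓ₁ ℓ₂}
                 {r₁ r₂ ε a : OrderedField.Carrier R} {m : ℕ}
                 (𝓛 : Network H R r₁ r₂ ε a m)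
                 {B : Subset (ConceptHierarchy.nD H)} {x : ℕ → Fin (Network.nN 𝓛) → Bool}
                 (execution : Network.IsExecution 𝓛 B x) where
  open ConceptHierarchy H
  open OrderedField R using (Carrier; _*_; _-_; 1#; 0#; fromℕ; *-nonneg; *-assoc; *-commutativeSemigroup)
    renaming (_≤_ to infix 4 _⊑_)
  open OrderedFieldProperties R
  open CommutativeSemigroupProperties *-commutativeSemigroup using (x∙yz≈y∙xz)
  open PartialOrderReasoning poset
  open Network 𝓛
  open IsExecution execution
  open Support H R
  open SupportProperties H R

  LiveRepsFire : ℕ → Fin nD → Set
  LiveRepsFire t d = ∀ {u} → u ∈ reps d → u ∉ F → x t u ≡ true

  liveLinks : Fin nD → Fin nN → Subset nN
  liveLinks e v = reps e ∩ (∁ F ∩ tabulate (λ u → E u v))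

  liveLinks⊆input : ∀ {d e v t} → d ∈ C → 1 ≤ level d → v ∈ reps d → e ∈ children d →
                    LiveRepsFire t e → liveLinks e v ⊆ tabulate (λ u → w u v ∧ x t u)
  liveLinks⊆input {d} {e} {v} d∈C 1≤level v∈reps e∈children fire {u} u∈liveLinks =
    ∈-tabulate⁺ _ (≡.cong₂ _∧_ (≡.cong₂ _∧_ adjacent (∈-tabulate⁻ _ u∈E⁻¹v)) (fire u∈reps u∉F))
    where
      u∈reps : u ∈ reps e
      u∈reps = proj₁ (x∈p∩q⁻ _ _ u∈liveLinks)
      u∉F : u ∉ F
      u∉F = x∈∁p⇒x∉p (proj₁ (x∈p∩q⁻ _ _ (proj₂ (x∈p∩q⁻ _ _ u∈liveLinks))))
      u∈E⁻¹v : u ∈ tabulate (λ u′ → E u′ v)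
      u∈E⁻¹v = proj₂ (x∈p∩q⁻ _ _ (proj₂ (x∈p∩q⁻ _ _ u∈liveLinks)))
      e∈C×level : e ∈ C × suc (level e) ≡ level d
      e∈C×level = children-⊆ d d∈C 1≤level e e∈children
      adjacent-layers : suc (layer u) ≡ layer v
      adjacent-layers = ≡.trans (≡.cong suc (reps-layer e (proj₁ e∈C×level) u u∈reps))
                                (≡.trans (proj₂ e∈C×level) (≡.sym (reps-layer d d∈C v v∈reps)))
      adjacent : (suc (layer u) ℕ.≡ᵇ layer v) ≡ true
      adjacent = Equivalence.to T-≡ (ℕₚ.≡⇒≡ᵇ (suc (layer u)) (layer v) adjacent-layers)

  liveLinks-disjoint : ∀ {e e′ v} → e ∈ C → e′ ∈ C → e ≢ e′ →
                       ∀ {u} → u ∈ liveLinks e v → u ∉ liveLinks e′ v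
  liveLinks-disjoint e∈C e′∈C e≢e′ u∈ u∈′ =
    reps-disj _ _ e∈C e′∈C e≢e′ _ (proj₁ (x∈p∩q⁻ _ _ u∈)) (proj₁ (x∈p∩q⁻ _ _ u∈′))

  τ⊑input : ∀ {d v t} (S : Subset nD) → d ∈ C → 1 ≤ level d → v ∈ reps d →
            (∀ {e} → e ∈ S → e ∈ children d × LiveRepsFire t e) →
            r₂ * fromℕ k ⊑ fromℕ ∣ S ∣ →
            τ ⊑ fromℕ (input x t v)
  τ⊑input {d} {v} {t} S d∈C 1≤level v∈reps S-fire r₂k⊑∣S∣ =
    a*q⊑y⇒a*p⊑y 0⊑r₂kM r₂kM⊑∣S∣M (0⊑fromℕ (input x t v)) (begin
      a * (fromℕ ∣ S ∣ * M)   ≈⟨ x∙yz≈y∙xz a (fromℕ ∣ S ∣) M ⟩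
      fromℕ ∣ S ∣ * (a * M)   ≤⟨ ∣S∣*α⊑∣U∣ (a * M) S (λ e → liveLinks e v) _
                                   liveLinks⊆input′ liveLinks-disjoint′ liveLinks-large ⟩
      fromℕ (input x t v)     ∎)
    where
      M : Carrier
      M = fromℕ m * (1# - ε)
      0⊑M : 0# ⊑ M
      0⊑M = *-nonneg (0⊑fromℕ m) (x⊑y⇒0⊑y-x (proj₂ ε∈[0,1]))
      0⊑r₂kM : 0# ⊑ r₂ * (fromℕ k * M)
      0⊑r₂kM = *-nonneg (proj₁ r₂∈[0,1]) (*-nonneg (0⊑fromℕ k) 0⊑M)
      r₂kM⊑∣S∣M : r₂ * (fromℕ k * M) ⊑ fromℕ ∣ S ∣ * M
      r₂kM⊑∣S∣M = begin
        r₂ * (fromℕ k * M)  ≈⟨ *-assoc r₂ (fromℕ k) M ⟨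
        r₂ * fromℕ k * M    ≤⟨ *-monoʳ-⊑ 0⊑M r₂k⊑∣S∣ ⟩
        fromℕ ∣ S ∣ * M     ∎
      ∈C : ∀ {e} → e ∈ S → e ∈ C
      ∈C e∈S = proj₁ (children-⊆ d d∈C 1≤level _ (proj₁ (S-fire e∈S)))
      liveLinks⊆input′ : ∀ {e} → e ∈ S → liveLinks e v ⊆ tabulate (λ u → w u v ∧ x t u)
      liveLinks⊆input′ e∈S =
        liveLinks⊆input d∈C 1≤level v∈reps (proj₁ (S-fire e∈S)) (proj₂ (S-fire e∈S))
      liveLinks-disjoint′ : ∀ {e e′} → e ∈ S → e′ ∈ S → e ≢ e′ →
                            ∀ {u} → u ∈ liveLinks e v → u ∉ liveLinks e′ v
      liveLinks-disjoint′ e∈S e′∈S = liveLinks-disjoint (∈C e∈S) (∈C e′∈S)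
      liveLinks-large : ∀ {e} → e ∈ S → a * M ⊑ fromℕ ∣ liveLinks e v ∣
      liveLinks-large e∈S = F-edges d d∈C 1≤level v v∈reps _ (proj₁ (S-fire e∈S))

  InB⇒LiveRepsFire : ∀ ℓ {d} → InB B r₂ ℓ d → LiveRepsFire ℓ d
  InB⇒LiveRepsFire zero {d} (lift (d∈B , d∈C , level≡0)) {u} u∈reps u∉F =
    input-fires⁻ u (≡.trans (reps-layer d d∈C u u∈reps) level≡0) u∉F d d∈B u∈reps
  InB⇒LiveRepsFire (suc ℓ) {d} (lift (d∈C , level≡) , S , S⊆ , r₂k⊑∣S∣) {u} u∈reps u∉F =
    rule⁻ ℓ u 1≤layer u∉F (τ⊑input S d∈C 1≤level u∈reps S-fire r₂k⊑∣S∣)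
    where
      1≤level : 1 ≤ level d
      1≤level = ≡.subst (1 ≤_) (≡.sym level≡) (s≤s z≤n)
      1≤layer : 1 ≤ layer u
      1≤layer = ≡.subst (1 ≤_) (≡.sym (reps-layer d d∈C u u∈reps)) 1≤level
      S-fire : ∀ {e} → e ∈ S → e ∈ children d × LiveRepsFire ℓ e
      S-fire {e} e∈S = lower (proj₁ (S⊆ e e∈S)) , InB⇒LiveRepsFire ℓ (proj₂ (S⊆ e e∈S))

  InB⇒many-fire : ∀ ℓ {d} → InB B r₂ ℓ d →
                  fromℕ m * (1# - ε) ⊑ fromℕ ∣ reps d ∩ tabulate (x (level d)) ∣
  InB⇒many-fire ℓ {d} d∈Bℓ with InB⇒∈C×level≡ ℓ d∈Bℓ
  ... | d∈C , refl = ⊑-trans (F-reps d d∈C) (fromℕ-mono (p⊆q⇒∣p∣≤∣q∣ live⊆firing))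
    where
      live⊆firing : reps d ∩ ∁ F ⊆ reps d ∩ tabulate (x (level d))
      live⊆firing u∈ = x∈p∩q⁺ (u∈reps , ∈-tabulate⁺ _ (InB⇒LiveRepsFire ℓ d∈Bℓ u∈reps u∉F))
        where
          u∈reps : _ ∈ reps d
          u∈reps = proj₁ (x∈p∩q⁻ (reps d) (∁ F) u∈)
          u∉F : _ ∉ F
          u∉F = x∈∁p⇒x∉p (proj₂ (x∈p∩q⁻ (reps d) (∁ F) u∈))

theorem15 : ∀ {ℓmax n k : ℕ} → 1 ≤ ℓmax → 1 ≤ n → 1 ≤ k →
    (H : ConceptHierarchy ℓmax n k) →
    ∀ {c ℓ₁ ℓ₂} (R : OrderedField c ℓ₁ ℓ₂) →
    (r₁ r₂ ε a : OrderedField.Carrier R) (m : ℕ) → 1 ≤ m →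
    (𝓛 : Network H R r₁ r₂ ε a m) →
    (B : Subset (ConceptHierarchy.nD H)) →
    B ⊆ (ConceptHierarchy.C H ∩ levelSet (ConceptHierarchy.level H) 0) →
    (x : ℕ → Fin (Network.nN 𝓛) → Bool) →
    Network.IsExecution 𝓛 B x →
    ∀ d → Support.InSupp H R B r₂ d →
    OrderedField._≤_ R
      (OrderedField._*_ R (OrderedField.fromℕ R m)
                          (OrderedField._-_ R (OrderedField.1# R) ε))
      (OrderedField.fromℕ R
        ∣ Network.reps 𝓛 d ∩ tabulate (x (ConceptHierarchy.level H d)) ∣)
theorem15 _ _ _ _ _ _ _ _ _ _ _ 𝓛 _ _ _ execution _ (ℓ , _ , d∈Bℓ) =
  Execution.InB⇒many-fire 𝓛 execution ℓ d∈Bℓ
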